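{- Let $(\mathbf C,\mathbf C_{\mathrm{free}})$ be a partitioned process theory and let $(X,\ge,\cdot)$ be a non-negative ordered monoid with unit $1$. A function $\mu:\mathrm{mor}(\mathbf C)\to X$ induces a (well-defined) order-preserving monoid homomorphism $$M:(\lvert\mathrm{PCD}(\mathbf C,\mathbf C_{\mathrm{free}})\rvert,\succeq,\otimes)\to(X,\ge,\cdot),\qquad [f]\mapsto\mu(f),$$ if and only if for all objects $Z$ of $\mathbf C$, all morphisms $f,g$ of $\mathbf C$ and all morphisms $\xi$ of $\mathbf C_{\mathrm{free}}$: (i) $\mu(f\otimes g)=\mu(f)\cdot\mu(g)$; (ii) $\mu(1_Z)=1$; (iii) $\mu(f)\ge\mu(\xi\circ f)$ and $\mu(f)\ge\mu(f\circ\xi)$ whenever these composites are defined. Moreover, this gives a one-to-one correspondence: every order-preserving monoid homomorphism from $(\lvert\mathrm{PCD}(\mathbf C,\mathbf C_{\mathrm{free}})\rvert,\succeq,\otimes)$ to $(X,\ge,\cdot)$ arises from a unique such function $\mu$.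
   Context: A partitioned process theory $(\mathbf C,\mathbf C_{\mathrm{free}})$ is a small symmetric monoidal category $\mathbf C$ (product $\otimes$) together with a symmetric monoidal subcategory $\mathbf C_{\mathrm{free}}$ containing all objects of $\mathbf C$; $\mathrm{mor}(\mathbf C)$ denotes the set of morphisms. For $f,g\in\mathrm{mor}(\mathbf C)$ write $f\succeq g$ if there exist an object $Z$ of $\mathbf C$, morphisms $\xi_1,\xi_2$ of $\mathbf C_{\mathrm{free}}$ and a morphism $j$ of $\mathbf C$ with $\xi_2\circ(f\otimes 1_Z)\circ\xi_1=g\otimes j$. This is a preorder compatible with $\otimes$ (existence of morphisms in the symmetric monoidal category $\mathrm{PCD}(\mathbf C,\mathbf C_{\mathrm{free}})$ of "parallel-combinable processes with discarding"). Identifying $f,g$ when $f\succeq g$ and $g\succeq f$ gives the commutative ordered monoid $(\lvert\mathrm{PCD}(\mathbf C,\mathbf C_{\mathrm{free}})\rvert,\succeq,\otimes)$ of equivalence classes $[f]$, with $[f]\otimes[g]=[f\otimes g]$ and unit the class of the identity morphisms. An ordered monoid $(X,\ge,\cdot)$ is a set with a partial order and monoid multiplication such that $x\ge y$, $z\ge w$ imply $x\cdot z\ge y\cdot w$; it is non-negative if $x\ge 1$ for all $x\in X$. -}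

module Defs where

open import Level using (0ℓ)
open import Data.Product using (Σ; Σ-syntax; _×_; _,_)
open import Relation.Binary.PropositionalEquality using (_≡_)

record SymmetricMonoidalCategory : Set₁ where
  infixr 9 _∘_
  infixr 10 _⊗₀_ _⊗₁_
  field
    Obj : Set
    Hom : Obj → Obj → Set
    id  : ∀ {A} → Hom A A
    _∘_ : ∀ {A B C} → Hom B C → Hom A B → Hom A C
    identityˡ : ∀ {A B} (f : Hom A B) → id ∘ f ≡ f
    identityʳ : ∀ {A B} (f : Hom A B) → f ∘ id ≡ f
    assoc : ∀ {A B C D} (h : Hom C D) (g : Hom B C) (f : Hom A B) →
            (h ∘ g) ∘ f ≡ h ∘ (g ∘ f)

    unit  : Obj
    _⊗₀_ : Obj → Obj → Obj
    _⊗₁_ : ∀ {A B C D} → Hom A B → Hom C D → Hom (A ⊗₀ C) (B ⊗₀ D)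
    ⊗-id : ∀ {A B} → id {A} ⊗₁ id {B} ≡ id
    ⊗-∘  : ∀ {A B C D E F} (f : Hom B C) (g : Hom A B) (h : Hom E F) (k : Hom D E) →
           (f ∘ g) ⊗₁ (h ∘ k) ≡ (f ⊗₁ h) ∘ (g ⊗₁ k)

    α   : ∀ {A B C} → Hom ((A ⊗₀ B) ⊗₀ C) (A ⊗₀ (B ⊗₀ C))
    α⁻¹ : ∀ {A B C} → Hom (A ⊗₀ (B ⊗₀ C)) ((A ⊗₀ B) ⊗₀ C)
    λ⇒  : ∀ {A} → Hom (unit ⊗₀ A) A
    λ⇐  : ∀ {A} → Hom A (unit ⊗₀ A)
    ρ⇒  : ∀ {A} → Hom (A ⊗₀ unit) A
    ρ⇐  : ∀ {A} → Hom A (A ⊗₀ unit)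
    σ   : ∀ {A B} → Hom (A ⊗₀ B) (B ⊗₀ A)

    α-iso₁ : ∀ {A B C} → α⁻¹ {A} {B} {C} ∘ α ≡ id
    α-iso₂ : ∀ {A B C} → α {A} {B} {C} ∘ α⁻¹ ≡ id
    λ-iso₁ : ∀ {A} → λ⇐ {A} ∘ λ⇒ ≡ id
    λ-iso₂ : ∀ {A} → λ⇒ {A} ∘ λ⇐ ≡ id
    ρ-iso₁ : ∀ {A} → ρ⇐ {A} ∘ ρ⇒ ≡ id
    ρ-iso₂ : ∀ {A} → ρ⇒ {A} ∘ ρ⇐ ≡ id
    σ-invol : ∀ {A B} → σ {B} {A} ∘ σ {A} {B} ≡ id

    α-natural : ∀ {A A′ B B′ C C′} (f : Hom A A′) (g : Hom B B′) (h : Hom C C′) →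
                α ∘ ((f ⊗₁ g) ⊗₁ h) ≡ (f ⊗₁ (g ⊗₁ h)) ∘ α
    λ-natural : ∀ {A B} (f : Hom A B) → λ⇒ ∘ (id {unit} ⊗₁ f) ≡ f ∘ λ⇒
    ρ-natural : ∀ {A B} (f : Hom A B) → ρ⇒ ∘ (f ⊗₁ id {unit}) ≡ f ∘ ρ⇒
    σ-natural : ∀ {A A′ B B′} (f : Hom A A′) (g : Hom B B′) →
                σ ∘ (f ⊗₁ g) ≡ (g ⊗₁ f) ∘ σ

    pentagon : ∀ {A B C D} →
               (id {A} ⊗₁ α {B} {C} {D}) ∘ α ∘ (α ⊗₁ id {D}) ≡ α ∘ α
    triangle : ∀ {A B} → (id {A} ⊗₁ λ⇒ {B}) ∘ α ≡ ρ⇒ ⊗₁ id {B}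
    hexagon  : ∀ {A B C} →
               α {B} {C} {A} ∘ σ {A} {B ⊗₀ C} ∘ α ≡ (id {B} ⊗₁ σ) ∘ α ∘ (σ ⊗₁ id {C})

-- Partitioned process theories: a symmetric monoidal subcategory C_free
-- containing all objects, given as a predicate on morphisms closed under
-- identities, composition, tensor, and containing the structural maps.

record PartitionedProcessTheory : Set₁ where
  field
    C : SymmetricMonoidalCategory
  open SymmetricMonoidalCategory C
  field
    Free : ∀ {A B} → Hom A B → Set
    free-id : ∀ {A} → Free (id {A})
    free-∘  : ∀ {A B D} {f : Hom B D} {g : Hom A B} → Free f → Free g → Free (f ∘ g)
    free-⊗  : ∀ {A B D E} {f : Hom A B} {g : Hom D E} → Free f → Free g → Free (f ⊗₁ g)
    free-α   : ∀ {A B D} → Free (α {A} {B} {D})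
    free-α⁻¹ : ∀ {A B D} → Free (α⁻¹ {A} {B} {D})
    free-λ⇒  : ∀ {A} → Free (λ⇒ {A})
    free-λ⇐  : ∀ {A} → Free (λ⇐ {A})
    free-ρ⇒  : ∀ {A} → Free (ρ⇒ {A})
    free-ρ⇐  : ∀ {A} → Free (ρ⇐ {A})
    free-σ   : ∀ {A B} → Free (σ {A} {B})

module PPT (T : PartitionedProcessTheory) where
  open PartitionedProcessTheory T public
  open SymmetricMonoidalCategory C public

  Mor : Set
  Mor = Σ[ A ∈ Obj ] Σ[ B ∈ Obj ] Hom A B

  ⌞_⌟ : ∀ {A B} → Hom A B → Mor
  ⌞_⌟ {A} {B} f = A , B , f

  infix 4 _⪰_
  _⪰_ : Mor → Mor → Set
  (A , B , f) ⪰ (A′ , B′ , g) =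
    Σ[ Z ∈ Obj ] Σ[ A″ ∈ Obj ] Σ[ B″ ∈ Obj ] Σ[ j ∈ Hom A″ B″ ]
    Σ[ ξ₁ ∈ Hom (A′ ⊗₀ A″) (A ⊗₀ Z) ] Σ[ ξ₂ ∈ Hom (B ⊗₀ Z) (B′ ⊗₀ B″) ]
      (Free ξ₁ × Free ξ₂ × (ξ₂ ∘ (f ⊗₁ id {Z}) ∘ ξ₁ ≡ g ⊗₁ j))

  -- the equivalence whose classes form |PCD(C, C_free)|
  _∼_ : Mor → Mor → Set
  f ∼ g = (f ⪰ g) × (g ⪰ f)

record OrderedMonoid : Set₁ where
  infix 4 _≥_
  infixl 7 _·_
  field
    Carrier : Set
    _≥_ : Carrier → Carrier → Set
    ≥-refl    : ∀ {x} → x ≥ x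
    ≥-trans   : ∀ {x y z} → x ≥ y → y ≥ z → x ≥ z
    ≥-antisym : ∀ {x y} → x ≥ y → y ≥ x → x ≡ y
    _·_ : Carrier → Carrier → Carrier
    1#  : Carrier
    ·-assoc : ∀ x y z → (x · y) · z ≡ x · (y · z)
    ·-identityˡ : ∀ x → 1# · x ≡ x
    ·-identityʳ : ∀ x → x · 1# ≡ x
    ·-mono : ∀ {x y z w} → x ≥ y → z ≥ w → x · z ≥ y · w

NonNegative : OrderedMonoid → Set
NonNegative X = ∀ x → x ≥ 1#
  where open OrderedMonoid X

module _ (T : PartitionedProcessTheory) (X : OrderedMonoid) where
  open PPT T
  open OrderedMonoid X

  -- A function on mor(C) that descends to a well-defined, order-preserving
  -- monoid homomorphism (|PCD(C,C_free)|, ⪰, ⊗) → (X, ≥, ·), [f] ↦ φ f.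
  -- (The unit of |PCD| is the class of the identity morphisms, [1_unit].)
  record InducesPCDHom (φ : Mor → Carrier) : Set where
    field
      well-defined : ∀ f g → f ∼ g → φ f ≡ φ g
      monotone     : ∀ f g → f ⪰ g → φ f ≥ φ g
      preserves-⊗  : ∀ {A B D E} (f : Hom A B) (g : Hom D E) →
                     φ ⌞ f ⊗₁ g ⌟ ≡ φ ⌞ f ⌟ · φ ⌞ g ⌟
      preserves-1  : φ ⌞ id {unit} ⌟ ≡ 1#

  record Conditions (μ : Mor → Carrier) : Set where
    field
      cond-i   : ∀ {A B D E} (f : Hom A B) (g : Hom D E) →
                 μ ⌞ f ⊗₁ g ⌟ ≡ μ ⌞ f ⌟ · μ ⌞ g ⌟
      cond-ii  : ∀ (Z : Obj) → μ ⌞ id {Z} ⌟ ≡ 1#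
      cond-iii-post : ∀ {A B D} (f : Hom A B) (ξ : Hom B D) → Free ξ →
                      μ ⌞ f ⌟ ≥ μ ⌞ ξ ∘ f ⌟
      cond-iii-pre  : ∀ {A B D} (f : Hom A B) (ξ : Hom D A) → Free ξ →
                      μ ⌞ f ⌟ ≥ μ ⌞ f ∘ ξ ⌟

-- Conditions (i)–(iii) are exactly what is needed to follow a witness
-- ξ₂ ∘ (f ⊗ 1_Z) ∘ ξ₁ = g ⊗ j of f ⪰ g through μ: tensoring with 1_Z costs
-- nothing by (i) and (ii), composing with the free ξ₁, ξ₂ can only decrease μ
-- by (iii), and discarding j can only decrease μ because μ j ≥ 1.
-- Monotonicity then yields well-definedness by antisymmetry. Conversely, a
-- homomorphism on |PCD| satisfies (ii) since all identities are equivalent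
-- (1_Z ⊗ 1_unit and 1_unit ⊗ 1_Z differ by free swaps), and (iii) since
-- f ⪰ ξ ∘ f and f ⪰ f ∘ ξ with Z the monoidal unit.
module Submission where

open import Defs
open import Data.Product using (Σ-syntax; _×_; _,_)
open import Relation.Binary.Bundles using (Preorder)
open import Relation.Binary.PropositionalEquality
  using (_≡_; refl; cong; isEquivalence; module ≡-Reasoning)
import Relation.Binary.Reasoning.Preorder as PreorderReasoning

module OrderedMonoidProperties (X : OrderedMonoid) where
  open OrderedMonoid X

  ≥-preorder : Preorder _ _ _
  ≥-preorder = record
    { Carrier    = Carrier
    ; _≈_        = _≡_
    ; _≲_        = _≥_
    ; isPreorder = record
      { isEquivalence = isEquivalence
      ; reflexive     = λ { refl → ≥-refl }
      ; trans         = ≥-trans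
      }
    }

  module ≥-Reasoning = PreorderReasoning ≥-preorder

  x·y≥x : NonNegative X → ∀ x y → x · y ≥ x
  x·y≥x nonneg x y = begin
    x · y   ≲⟨ ·-mono ≥-refl (nonneg y) ⟩
    x · 1#  ≡⟨ ·-identityʳ x ⟩
    x       ∎
    where open ≥-Reasoning

module PartitionedProcessTheoryProperties (T : PartitionedProcessTheory) where
  open PPT T

  ⊗id-∘ : ∀ {A B D Z} (g : Hom B D) (f : Hom A B) →
          (g ⊗₁ id {Z}) ∘ (f ⊗₁ id) ≡ (g ∘ f) ⊗₁ id
  ⊗id-∘ g f = begin
    (g ⊗₁ id) ∘ (f ⊗₁ id)  ≡⟨ ⊗-∘ g f id id ⟨
    (g ∘ f) ⊗₁ (id ∘ id)   ≡⟨ cong ((g ∘ f) ⊗₁_) (identityˡ id) ⟩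
    (g ∘ f) ⊗₁ id          ∎
    where open ≡-Reasoning

  id⪰id : ∀ A B → ⌞ id {A} ⌟ ⪰ ⌞ id {B} ⌟
  id⪰id A B = B , A , A , id , σ , σ , free-σ , free-σ , swap-swap
    where
    open ≡-Reasoning
    swap-swap : σ ∘ (id ⊗₁ id) ∘ σ ≡ id ⊗₁ id
    swap-swap = begin
      σ ∘ (id ⊗₁ id) ∘ σ  ≡⟨ cong (λ h → σ ∘ h ∘ σ) ⊗-id ⟩
      σ ∘ id ∘ σ          ≡⟨ cong (σ ∘_) (identityˡ σ) ⟩
      σ ∘ σ               ≡⟨ σ-invol ⟩
      id                  ≡⟨ ⊗-id ⟨
      id ⊗₁ id            ∎

  id∼id : ∀ A B → ⌞ id {A} ⌟ ∼ ⌞ id {B} ⌟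
  id∼id A B = id⪰id A B , id⪰id B A

  f⪰ξ∘f : ∀ {A B D} (f : Hom A B) {ξ : Hom B D} → Free ξ → ⌞ f ⌟ ⪰ ⌞ ξ ∘ f ⌟
  f⪰ξ∘f f {ξ} free-ξ =
    unit , unit , unit , id , id , ξ ⊗₁ id , free-id , free-⊗ free-ξ free-id , (begin
      (ξ ⊗₁ id) ∘ (f ⊗₁ id) ∘ id  ≡⟨ cong ((ξ ⊗₁ id) ∘_) (identityʳ (f ⊗₁ id)) ⟩
      (ξ ⊗₁ id) ∘ (f ⊗₁ id)       ≡⟨ ⊗id-∘ ξ f ⟩
      (ξ ∘ f) ⊗₁ id               ∎)
    where open ≡-Reasoning

  f⪰f∘ξ : ∀ {A B D} (f : Hom A B) {ξ : Hom D A} → Free ξ → ⌞ f ⌟ ⪰ ⌞ f ∘ ξ ⌟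
  f⪰f∘ξ f {ξ} free-ξ =
    unit , unit , unit , id , ξ ⊗₁ id , id , free-⊗ free-ξ free-id , free-id , (begin
      id ∘ (f ⊗₁ id) ∘ (ξ ⊗₁ id)  ≡⟨ identityˡ _ ⟩
      (f ⊗₁ id) ∘ (ξ ⊗₁ id)       ≡⟨ ⊗id-∘ f ξ ⟩
      (f ∘ ξ) ⊗₁ id               ∎)
    where open ≡-Reasoning

module _ (T : PartitionedProcessTheory) (X : OrderedMonoid) where
  open PPT T
  open OrderedMonoid X
  open OrderedMonoidProperties X
  open PartitionedProcessTheoryProperties T

  InducesPCDHom⇒Conditions : ∀ {μ} → InducesPCDHom T X μ → Conditions T X μ
  InducesPCDHom⇒Conditions {μ} hom = record
    { cond-i        = preserves-⊗
    ; cond-ii       = λ Z → begin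
        μ ⌞ id {Z} ⌟     ≡⟨ well-defined _ _ (id∼id Z unit) ⟩
        μ ⌞ id {unit} ⌟  ≡⟨ preserves-1 ⟩
        1#               ∎
    ; cond-iii-post = λ f ξ free-ξ → monotone _ _ (f⪰ξ∘f f free-ξ)
    ; cond-iii-pre  = λ f ξ free-ξ → monotone _ _ (f⪰f∘ξ f free-ξ)
    }
    where
    open InducesPCDHom hom
    open ≡-Reasoning

  module _ (nonneg : NonNegative X) {μ : Mor → Carrier} (conds : Conditions T X μ) where
    open Conditions conds

    Conditions⇒monotone : ∀ f g → f ⪰ g → μ f ≥ μ g
    Conditions⇒monotone (_ , _ , f) (_ , _ , g) (Z , _ , _ , j , ξ₁ , ξ₂ , free-ξ₁ , free-ξ₂ , eq) =
      begin
        μ ⌞ f ⌟                            ≡⟨ ·-identityʳ _ ⟨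
        μ ⌞ f ⌟ · 1#                       ≡⟨ cong (μ ⌞ f ⌟ ·_) (cond-ii Z) ⟨
        μ ⌞ f ⌟ · μ ⌞ id {Z} ⌟             ≡⟨ cond-i f id ⟨
        μ ⌞ f ⊗₁ id ⌟                      ≲⟨ cond-iii-pre (f ⊗₁ id) ξ₁ free-ξ₁ ⟩
        μ ⌞ (f ⊗₁ id) ∘ ξ₁ ⌟               ≲⟨ cond-iii-post _ ξ₂ free-ξ₂ ⟩
        μ ⌞ ξ₂ ∘ (f ⊗₁ id) ∘ ξ₁ ⌟          ≡⟨ cong (λ h → μ ⌞ h ⌟) eq ⟩
        μ ⌞ g ⊗₁ j ⌟                       ≡⟨ cond-i g j ⟩
        μ ⌞ g ⌟ · μ ⌞ j ⌟                  ≲⟨ x·y≥x nonneg _ _ ⟩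
        μ ⌞ g ⌟                            ∎
      where open ≥-Reasoning

    Conditions⇒InducesPCDHom : InducesPCDHom T X μ
    Conditions⇒InducesPCDHom = record
      { well-defined = λ { f g (f⪰g , g⪰f) →
          ≥-antisym (Conditions⇒monotone f g f⪰g) (Conditions⇒monotone g f g⪰f) }
      ; monotone     = Conditions⇒monotone
      ; preserves-⊗  = cond-i
      ; preserves-1  = cond-ii unit
      }

theorem3p4 : (T : PartitionedProcessTheory) (X : OrderedMonoid) → NonNegative X →
    ((μ : PPT.Mor T → OrderedMonoid.Carrier X) →
      (InducesPCDHom T X μ → Conditions T X μ) × (Conditions T X μ → InducesPCDHom T X μ))
    × ((M : PPT.Mor T → OrderedMonoid.Carrier X) → InducesPCDHom T X M →
      Σ[ μ ∈ (PPT.Mor T → OrderedMonoid.Carrier X) ]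
        (Conditions T X μ × (∀ f → μ f ≡ M f)
         × ((μ′ : PPT.Mor T → OrderedMonoid.Carrier X) → Conditions T X μ′ →
            (∀ f → μ′ f ≡ M f) → ∀ f → μ′ f ≡ μ f)))
theorem3p4 T X nonneg =
  (λ μ → InducesPCDHom⇒Conditions T X , Conditions⇒InducesPCDHom T X nonneg) ,
  (λ M hom → M , InducesPCDHom⇒Conditions T X hom , (λ _ → refl) , λ _ _ μ′≡M → μ′≡M)
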